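{- For every integer $n\ge 0$, $$B_n \setminus \{0\} = \bigcup_{j=0}^{\lfloor n/2 \rfloor} \{ x+iy \in \mathbb{Z}[i] : 2^j \parallel (x,y);\ |x|,|y| \leq w_n - 2^{j+1};\ |x|+|y| \leq w_{n+1} - 3\cdot 2^j \}.$$
   Context: For $n\ge 0$, $B_n = \left\{ \sum_{j=0}^n v_j (1+i)^j : v_j \in \{0,\pm 1,\pm i\}\right\} \subset \mathbb{Z}[i]$. The sequence $(w_k)_{k\ge0}$ is defined by $w_{2m} = 2^{m+1}+2^m$ and $w_{2m+1} = 2^{m+2}$. For integers $x,y$, the notation $2^j \parallel (x,y)$ means $2^j$ divides both $x$ and $y$ but $2^{j+1}$ does not divide both, i.e. $2^j$ is the exact power of $2$ dividing $\gcd(x,y)$. -}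

module Defs where

open import Data.Nat as ℕ using (ℕ; zero; suc; _/_; _%_)
open import Data.Integer as ℤ using (ℤ; +_; -_; _+_; _-_; _*_; 0ℤ; 1ℤ; -1ℤ)
open import Data.Integer.Divisibility using (_∣_)
open import Data.Fin using (Fin; zero; suc)
open import Data.Product using (_×_; _,_; ∃; proj₁; proj₂)
open import Relation.Nullary using (¬_)
open import Relation.Binary.PropositionalEquality using (_≡_)

-- Gaussian integers x + i y as pairs (x , y)
ℤ[i] : Set
ℤ[i] = ℤ × ℤ

_+ᵍ_ : ℤ[i] → ℤ[i] → ℤ[i]
(a , b) +ᵍ (c , d) = (a + c , b + d)

_*ᵍ_ : ℤ[i] → ℤ[i] → ℤ[i]
(a , b) *ᵍ (c , d) = (a * c - b * d , a * d + b * c)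

0ᵍ : ℤ[i]
0ᵍ = (0ℤ , 0ℤ)

1ᵍ : ℤ[i]
1ᵍ = (1ℤ , 0ℤ)

1+i : ℤ[i]
1+i = (1ℤ , 1ℤ)

_^ᵍ_ : ℤ[i] → ℕ → ℤ[i]
z ^ᵍ zero  = 1ᵍ
z ^ᵍ suc k = z *ᵍ (z ^ᵍ k)

Σᵍ : ∀ {m} → (Fin m → ℤ[i]) → ℤ[i]
Σᵍ {zero}  f = 0ᵍ
Σᵍ {suc m} f = f zero +ᵍ Σᵍ (λ k → f (suc k))

data Digit : Set where
  d0 d1 d-1 di d-i : Digit

digitVal : Digit → ℤ[i]
digitVal d0  = (0ℤ , 0ℤ)
digitVal d1  = (1ℤ , 0ℤ)
digitVal d-1 = (-1ℤ , 0ℤ)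
digitVal di  = (0ℤ , 1ℤ)
digitVal d-i = (0ℤ , -1ℤ)

InB : ℕ → ℤ[i] → Set
InB n z = ∃ λ (v : Fin (suc n) → Digit) →
  Σᵍ (λ j → digitVal (v j) *ᵍ (1+i ^ᵍ Data.Fin.toℕ j)) ≡ z

w : ℕ → ℕ
w k with k % 2
... | zero  = 2 ℕ.^ (k / 2 ℕ.+ 1) ℕ.+ 2 ℕ.^ (k / 2)
... | suc _ = 2 ℕ.^ (k / 2 ℕ.+ 2)

_∥_ : ℕ → ℤ[i] → Set
j ∥ (x , y) = (+ (2 ℕ.^ j) ∣ x × + (2 ℕ.^ j) ∣ y)
            × ¬ (+ (2 ℕ.^ suc j) ∣ x × + (2 ℕ.^ suc j) ∣ y)

module Submission where

-- Since (1 + i)² = 2i and B n is invariant under multiplication by i, two steps of the digit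
-- expansion give B (n + 2) = B₁ + 2 B n.  Everything else is a statement about the pair
-- (∣ x ∣ , ∣ y ∣), and the right-hand side S n (together with 0) obeys the same recursion: as
-- w (n + 2) = 2 w n, its layer j + 1 at level n + 2 is twice its layer j at level n, while a pair
-- with an odd coordinate in the layer 0 at level n + 2 is a point of B₁ plus twice a pair of the
-- layer 0 at level n, found by a case analysis on the parities of the halved coordinates.
-- Conversely B₁ + 2 S n lies in S (n + 2) by the triangle inequality.  Together with the cases
-- n = 0 and n = 1, checked directly, induction on n gives B n ∖ {0} = S n.

open import Defs

module OnAbsoluteValues where

  open import Data.Nat
  open import Data.Nat.Properties
  open import Data.Nat.Divisibility
    using (_∣_; _∣?_; divides; ∣-refl; _∣0; 1∣_; ∣-trans; m∣m*n; *-monoʳ-∣; *-cancelˡ-∣;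
           m∣n⇒n≡m*quotient; quotient; ∣m+n∣m⇒∣n; ∣m∣n⇒∣m+n; ∣1⇒≡1)
  open import Data.Nat.DivMod using (m/n≡1+[m∸n]/n)
  open import Data.Nat.Tactic.RingSolver using (solve)
  open import Data.List using (_∷_; [])
  open import Data.Product using (_×_; _,_; ∃; proj₁; proj₂; swap)
  open import Data.Sum using (_⊎_; inj₁; inj₂)
  open import Function using (_∘_)
  open import Data.Empty using (⊥-elim)
  open import Relation.Nullary using (¬_; Dec; yes; no)
  open import Relation.Nullary.Decidable using (_×-dec_; ¬?; from-yes)
  open import Relation.Binary.PropositionalEquality
    using (_≡_; refl; sym; trans; cong; subst; subst₂; module ≡-Reasoning)

  [2+n]/2≡1+n/2 : ∀ n → (2 + n) / 2 ≡ suc (n / 2)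
  [2+n]/2≡1+n/2 n = m/n≡1+[m∸n]/n {2 + n} {2} (s≤s (s≤s z≤n))

  private
    w-by-parity : ℕ → ℕ → ℕ
    w-by-parity k zero    = 2 ^ (k / 2 + 1) + 2 ^ (k / 2)
    w-by-parity k (suc _) = 2 ^ (k / 2 + 2)

    w≡w-by-parity : ∀ k → w k ≡ w-by-parity k (k % 2)
    w≡w-by-parity k with k % 2
    ... | zero  = refl
    ... | suc _ = refl

    w-by-parity-double : ∀ n r → w-by-parity (2 + n) r ≡ 2 * w-by-parity n r
    w-by-parity-double n zero    rewrite [2+n]/2≡1+n/2 n = sym (*-distribˡ-+ 2 (2 ^ (n / 2 + 1)) (2 ^ (n / 2)))
    w-by-parity-double n (suc r) rewrite [2+n]/2≡1+n/2 n = refl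

  w-double : ∀ n → w (2 + n) ≡ 2 * w n
  w-double n = begin
    w (2 + n)                   ≡⟨ w≡w-by-parity (2 + n) ⟩
    w-by-parity (2 + n) (n % 2) ≡⟨ w-by-parity-double n (n % 2) ⟩
    2 * w-by-parity n (n % 2)   ≡⟨ cong (2 *_) (w≡w-by-parity n) ⟨
    2 * w n                     ∎
    where open ≡-Reasoning

  3≤w : ∀ n → 3 ≤ w n
  3≤w 0 = ≤-refl
  3≤w 1 = s≤s (s≤s (s≤s z≤n))
  3≤w (suc (suc n)) rewrite w-double n = ≤-trans (3≤w n) (m≤n*m (w n) 2)

  w<w-suc : ∀ n → w n < w (suc n)
  w<w-suc 0 = ≤-refl
  w<w-suc 1 = s≤s (s≤s (s≤s (s≤s (s≤s z≤n))))
  w<w-suc (suc (suc n)) rewrite w-double n | w-double (suc n) = *-monoʳ-< 2 (w<w-suc n)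

  w-suc+2≤2*w : ∀ n → w (suc n) + 2 ≤ 2 * w n
  w-suc+2≤2*w 0 = ≤-refl
  w-suc+2≤2*w 1 = ≤-refl
  w-suc+2≤2*w (suc (suc n)) rewrite w-double n | w-double (suc n) = begin
    2 * w (suc n) + 2      ≤⟨ +-monoʳ-≤ (2 * w (suc n)) (m≤n*m 2 2) ⟩
    2 * w (suc n) + 2 * 2  ≡⟨ *-distribˡ-+ 2 (w (suc n)) 2 ⟨
    2 * (w (suc n) + 2)    ≤⟨ *-monoʳ-≤ 2 (w-suc+2≤2*w n) ⟩
    2 * (2 * w n)          ∎
    where open ≤-Reasoning

  2∣w-suc : ∀ n → 2 ∣ w (suc n)
  2∣w-suc 0       = divides 2 refl
  2∣w-suc (suc n) rewrite w-double n = m∣m*n (w n)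

  data EvenOdd : ℕ → Set where
    even : ∀ k → EvenOdd (2 * k)
    odd  : ∀ k → EvenOdd (1 + 2 * k)

  evenOdd : ∀ n → EvenOdd n
  evenOdd zero = even 0
  evenOdd (suc n) with evenOdd n
  ... | even k = odd k
  ... | odd k  = subst EvenOdd (*-suc 2 k) (even (suc k))

  2∤1 : ¬ 2 ∣ 1
  2∤1 h with ∣1⇒≡1 h
  ... | ()

  2∣2* : ∀ k → 2 ∣ 2 * k
  2∣2* k = m∣m*n k

  2∣⇒2∤suc : ∀ {m} → 2 ∣ m → ¬ 2 ∣ suc m
  2∣⇒2∤suc {m} 2∣m h = 2∤1 (∣m+n∣m⇒∣n (subst (2 ∣_) (+-comm 1 m) h) 2∣m)

  2∤⇒2∤+2 : ∀ {m} → ¬ 2 ∣ m → ¬ 2 ∣ m + 2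
  2∤⇒2∤+2 {m} 2∤m h = 2∤m (∣m+n∣m⇒∣n (subst (2 ∣_) (+-comm m 2) h) ∣-refl)

  2∣⇒2∤⇒2∤+ : ∀ {m n} → 2 ∣ m → ¬ 2 ∣ n → ¬ 2 ∣ m + n
  2∣⇒2∤⇒2∤+ 2∣m 2∤n h = 2∤n (∣m+n∣m⇒∣n h 2∣m)

  odd≤even⇒< : ∀ {m n} → ¬ 2 ∣ m → 2 ∣ n → m ≤ n → m < n
  odd≤even⇒< 2∤m 2∣n m≤n = ≤∧≢⇒< m≤n (λ { refl → 2∤m 2∣n })

  halve-≤ : ∀ {m n} → 2 * m ≤ 2 * n → m ≤ n
  halve-≤ = *-cancelˡ-≤ 2

  halve-< : ∀ {m n} → 1 + 2 * m ≤ 2 * n → m < n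
  halve-< {m} {n} h = *-cancelˡ-< 2 m n h

  halve-odd : ∀ {m n} → 1 + 2 * m + 2 ≤ 2 * n → m + 2 ≤ n
  halve-odd {m} {n} h = subst (_≤ n) (sym (+-suc m 1)) (halve-< (begin
    1 + 2 * (m + 1)  ≡⟨ solve (m ∷ []) ⟩
    1 + 2 * m + 2    ≤⟨ h ⟩
    2 * n            ∎))
    where open ≤-Reasoning

  halve-even : ∀ {m n} → 2 * m + 2 ≤ 2 * n → m + 1 ≤ n
  halve-even {m} {n} h = halve-≤ (begin
    2 * (m + 1)  ≡⟨ solve (m ∷ []) ⟩
    2 * m + 2    ≤⟨ h ⟩
    2 * n        ∎)
    where open ≤-Reasoning

  halve-odd+odd : ∀ {m k n} → 1 + 2 * m + (1 + 2 * k) + 3 ≤ 2 * n → m + k + 3 ≤ n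
  halve-odd+odd {m} {k} {n} h = subst (_≤ n) (sym (+-suc (m + k) 2)) (halve-< (begin
    1 + 2 * (m + k + 2)          ≡⟨ solve (m ∷ k ∷ []) ⟩
    1 + 2 * m + (1 + 2 * k) + 3  ≤⟨ h ⟩
    2 * n                        ∎))
    where open ≤-Reasoning

  halve-odd+even : ∀ {m k n} → 1 + 2 * m + 2 * k + 3 ≤ 2 * n → m + k + 2 ≤ n
  halve-odd+even {m} {k} {n} h = halve-≤ (begin
    2 * (m + k + 2)        ≡⟨ solve (m ∷ k ∷ []) ⟩
    1 + 2 * m + 2 * k + 3  ≤⟨ h ⟩
    2 * n                  ∎)
    where open ≤-Reasoning

  odd+2≤even⇒+3 : ∀ {m n} → ¬ 2 ∣ m → 2 ∣ n → m + 2 ≤ n → m + 3 ≤ n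
  odd+2≤even⇒+3 {m} {n} 2∤m 2∣n h = subst (_≤ n) (sym (+-suc m 2)) (odd≤even⇒< (2∤⇒2∤+2 2∤m) 2∣n h)

  ≤-from-sum : ∀ {x y U} → U ≤ y → x + y ≤ 2 * U → x ≤ U
  ≤-from-sum {x} {y} {U} U≤y h = +-cancelʳ-≤ U x U (begin
    x + U     ≤⟨ +-monoʳ-≤ x U≤y ⟩
    x + y     ≤⟨ h ⟩
    2 * U     ≡⟨ cong (U +_) (+-identityʳ U) ⟩
    U + U     ∎)
    where open ≤-Reasoning

  odd+1≡2*suc : ∀ m → 1 + 2 * m + 1 ≡ 2 * suc m
  odd+1≡2*suc m = trans (+-comm (1 + 2 * m) 1) (sym (*-suc 2 m))

  Bounded : ℕ → ℕ → ℕ → ℕ → Set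
  Bounded U V a b = a + 2 ≤ U × b + 2 ≤ U × a + b + 3 ≤ V

  Primitive : ℕ → ℕ → ℕ → ℕ → Set
  Primitive U V a b = ¬ (2 ∣ a × 2 ∣ b) × Bounded U V a b

  -- The pairs (∣ x ∣ , ∣ y ∣) of the elements x + i y of B₁.
  data AbsB₁ : ℕ → ℕ → Set where
    b00 : AbsB₁ 0 0
    b10 : AbsB₁ 1 0
    b01 : AbsB₁ 0 1
    b11 : AbsB₁ 1 1
    b12 : AbsB₁ 1 2
    b21 : AbsB₁ 2 1

  AbsB₁-swap : ∀ {α β} → AbsB₁ α β → AbsB₁ β α
  AbsB₁-swap b00 = b00
  AbsB₁-swap b10 = b01
  AbsB₁-swap b01 = b10
  AbsB₁-swap b11 = b11
  AbsB₁-swap b12 = b21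
  AbsB₁-swap b21 = b12

  AbsB₁-bounds : ∀ {α β} → AbsB₁ α β → α ≤ 2 × β ≤ 2 × α + β ≤ 3
  AbsB₁-bounds b00 = z≤n , z≤n , z≤n
  AbsB₁-bounds b10 = s≤s z≤n , z≤n , s≤s z≤n
  AbsB₁-bounds b01 = z≤n , s≤s z≤n , s≤s z≤n
  AbsB₁-bounds b11 = s≤s z≤n , s≤s z≤n , s≤s (s≤s z≤n)
  AbsB₁-bounds b12 = s≤s z≤n , s≤s (s≤s z≤n) , s≤s (s≤s (s≤s z≤n))
  AbsB₁-bounds b21 = s≤s (s≤s z≤n) , s≤s z≤n , s≤s (s≤s (s≤s z≤n))

  AbsB₁-zero-or-primitive : ∀ {α β} → AbsB₁ α β → (α ≡ 0 × β ≡ 0) ⊎ ¬ (2 ∣ α × 2 ∣ β)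
  AbsB₁-zero-or-primitive b00 = inj₁ (refl , refl)
  AbsB₁-zero-or-primitive b10 = inj₂ (2∤1 ∘ proj₁)
  AbsB₁-zero-or-primitive b01 = inj₂ (2∤1 ∘ proj₂)
  AbsB₁-zero-or-primitive b11 = inj₂ (2∤1 ∘ proj₁)
  AbsB₁-zero-or-primitive b12 = inj₂ (2∤1 ∘ proj₁)
  AbsB₁-zero-or-primitive b21 = inj₂ (2∤1 ∘ proj₂)

  Bounded-digit+2* : ∀ {U V α β p q a b} → AbsB₁ α β → a ≤ α + 2 * p → b ≤ β + 2 * q →
                     Bounded U V p q → Bounded (2 * U) (2 * V) a b
  Bounded-digit+2* {U} {V} {α} {β} {p} {q} {a} {b} digit a≤ b≤ (p+2≤U , q+2≤U , p+q+3≤V)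
    with AbsB₁-bounds digit
  ... | α≤2 , β≤2 , α+β≤3 = coordinate a≤ α≤2 p+2≤U , coordinate b≤ β≤2 q+2≤U , sum
    where
    open ≤-Reasoning
    coordinate : ∀ {c γ r} → c ≤ γ + 2 * r → γ ≤ 2 → r + 2 ≤ U → c + 2 ≤ 2 * U
    coordinate {c} {γ} {r} c≤ γ≤2 r+2≤U = begin
      c + 2           ≤⟨ +-monoˡ-≤ 2 (≤-trans c≤ (+-monoˡ-≤ (2 * r) γ≤2)) ⟩
      2 + 2 * r + 2   ≡⟨ solve (r ∷ []) ⟩
      2 * (r + 2)     ≤⟨ *-monoʳ-≤ 2 r+2≤U ⟩
      2 * U           ∎
    sum : a + b + 3 ≤ 2 * V
    sum = begin
      a + b + 3                       ≤⟨ +-monoˡ-≤ 3 (+-mono-≤ a≤ b≤) ⟩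
      α + 2 * p + (β + 2 * q) + 3     ≡⟨ solve (α ∷ β ∷ p ∷ q ∷ []) ⟩
      (α + β) + 2 * (p + q) + 3       ≤⟨ +-monoˡ-≤ 3 (+-monoˡ-≤ (2 * (p + q)) α+β≤3) ⟩
      3 + 2 * (p + q) + 3             ≡⟨ solve (p ∷ q ∷ []) ⟩
      2 * (p + q + 3)                 ≤⟨ *-monoʳ-≤ 2 p+q+3≤V ⟩
      2 * V                           ∎

  infix 4 _≡±_+2*_
  _≡±_+2*_ : ℕ → ℕ → ℕ → Set
  a ≡± α +2* p = a ≡ α + 2 * p ⊎ a + α ≡ 2 * p

  -- U and V stand for w n and w (n + 1); these four facts are all that is used about them.
  module DigitChoice {U V : ℕ} (3≤U : 3 ≤ U) (U<V : U < V) (V+2≤2*U : V + 2 ≤ 2 * U) (2∣V : 2 ∣ V) where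

    record Decomposition (a b : ℕ) : Set where
      constructor decomposition
      field
        {α β p q}          : ℕ
        digit              : AbsB₁ α β
        split-a            : a ≡± α +2* p
        split-b            : b ≡± β +2* q
        quotient-primitive : Primitive U V p q

    Decomposition-swap : ∀ {a b} → Decomposition a b → Decomposition b a
    Decomposition-swap (decomposition {p = p} {q} digit sa sb (¬both , p+2≤U , q+2≤U , p+q+3≤V)) =
      decomposition (AbsB₁-swap digit) sb sa
        (¬both ∘ swap , q+2≤U , p+2≤U , subst (λ s → s + 3 ≤ V) (+-comm p q) p+q+3≤V)

    private
      squeeze : ∀ {x y} → U ≤ y → x + y ≤ V + 2 → x ≤ U
      squeeze U≤y h = ≤-from-sum U≤y (≤-trans h V+2≤2*U)

      -- 1 + 2P is written as 2 (P + 1) − 1, so that the new quotient P + 1 is odd.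
      odd-odd-bumped : ∀ {P Q} → 2 ∣ P → suc P + 2 ≤ U → Q + 2 ≤ U → P + Q + 3 < V →
                       Decomposition (1 + 2 * P) (1 + 2 * Q)
      odd-odd-bumped {P} 2∣P P+3≤U Q+2≤U P+Q+4≤V = decomposition b11 (inj₂ (odd+1≡2*suc P)) (inj₁ refl)
        (2∣⇒2∤suc 2∣P ∘ proj₁ , P+3≤U , Q+2≤U , P+Q+4≤V)

    decompose-odd-odd : ∀ P Q → P + 2 ≤ U → Q + 2 ≤ U → P + Q + 3 ≤ V →
                        Decomposition (1 + 2 * P) (1 + 2 * Q)
    decompose-odd-odd P Q P+2≤U Q+2≤U P+Q+3≤V with (2 ∣? P) ×-dec (2 ∣? Q)
    ... | no ¬both = decomposition b11 (inj₁ refl) (inj₁ refl) (¬both , P+2≤U , Q+2≤U , P+Q+3≤V)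
    ... | yes (2∣P , 2∣Q) = bump-one (suc P + 2 ≤? U)
      where
      P+Q+4≤V : P + Q + 3 < V
      P+Q+4≤V = odd≤even⇒< (subst (λ s → ¬ 2 ∣ s) (sym (+-suc (P + Q) 2))
                  (2∣⇒2∤suc (∣m∣n⇒∣m+n (∣m∣n⇒∣m+n 2∣P 2∣Q) ∣-refl))) 2∣V P+Q+3≤V
      bump-one : Dec (suc P + 2 ≤ U) → Decomposition (1 + 2 * P) (1 + 2 * Q)
      bump-one (yes P+3≤U) = odd-odd-bumped 2∣P P+3≤U Q+2≤U P+Q+4≤V
      bump-one (no P+3≰U) = Decomposition-swap
        (odd-odd-bumped 2∣Q Q+3≤U P+2≤U (subst (λ s → s + 3 < V) (+-comm P Q) P+Q+4≤V))
        where
        open ≤-Reasoning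
        Q+3≤U : suc Q + 2 ≤ U
        Q+3≤U = squeeze (≤-pred (≰⇒> P+3≰U)) (begin
          1 + Q + 2 + (P + 2)  ≡⟨ solve (P ∷ Q ∷ []) ⟩
          P + Q + 3 + 2        ≤⟨ +-monoˡ-≤ 2 P+Q+3≤V ⟩
          V + 2                ∎)

    private
      decompose-odd-zero : ∀ P → P + 2 ≤ U → P + 0 + 2 ≤ V → Decomposition (1 + 2 * P) 0
      decompose-odd-zero P P+2≤U P+2≤V with 2 ∣? P
      ... | no 2∤P = decomposition b10 (inj₁ refl) (inj₁ refl)
            (2∤P ∘ proj₁ , P+2≤U , ≤-trans (n≤1+n 2) 3≤U , odd+2≤even⇒+3 2∤P+0 2∣V P+2≤V)
        where
        2∤P+0 : ¬ 2 ∣ P + 0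
        2∤P+0 = subst (λ s → ¬ 2 ∣ s) (sym (+-identityʳ P)) 2∤P
      ... | yes 2∣P = decomposition b12 (inj₁ refl) (inj₂ refl) (2∤1 ∘ proj₂ , P+2≤U , 3≤U , P+4≤V)
        where
        open ≤-Reasoning
        P+4≤V : P + 1 + 3 ≤ V
        P+4≤V = begin
          P + 1 + 3    ≡⟨ solve (P ∷ []) ⟩
          2 + (P + 2)  ≤⟨ odd≤even⇒< (2∣⇒2∤suc (∣m∣n⇒∣m+n 2∣P ∣-refl)) 2∣V (≤-<-trans P+2≤U U<V) ⟩
          V            ∎

      decompose-odd-positive : ∀ P Q → P + 2 ≤ U → suc Q + 1 ≤ U → P + suc Q + 2 ≤ V →
                               Decomposition (1 + 2 * P) (2 * suc Q)
      decompose-odd-positive P Q P+2≤U [1+Q]+1≤U P+[1+Q]+2≤V = by-parity ((2 ∣? P) ×-dec (2 ∣? Q))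
        where
        open ≤-Reasoning
        Q+2≤U : Q + 2 ≤ U
        Q+2≤U = subst (_≤ U) (sym (+-suc Q 1)) [1+Q]+1≤U
        by-parity : Dec (2 ∣ P × 2 ∣ Q) → Decomposition (1 + 2 * P) (2 * suc Q)
        by-parity (no ¬both) = decomposition b12 (inj₁ refl) (inj₁ (*-suc 2 Q))
          (¬both , P+2≤U , Q+2≤U , P+Q+3≤V)
          where
          P+Q+3≤V : P + Q + 3 ≤ V
          P+Q+3≤V = begin
            P + Q + 3        ≡⟨ solve (P ∷ Q ∷ []) ⟩
            P + (1 + Q) + 2  ≤⟨ P+[1+Q]+2≤V ⟩
            V                ∎
        by-parity (yes (2∣P , 2∣Q)) = by-size (suc Q + 2 ≤? U)
          where
          P+[1+Q]+3≤V : P + suc Q + 3 ≤ V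
          P+[1+Q]+3≤V = odd+2≤even⇒+3 (2∣⇒2∤⇒2∤+ 2∣P (2∣⇒2∤suc 2∣Q)) 2∣V P+[1+Q]+2≤V
          by-size : Dec (suc Q + 2 ≤ U) → Decomposition (1 + 2 * P) (2 * suc Q)
          by-size (yes Q+3≤U) =
            decomposition b10 (inj₁ refl) (inj₁ refl) (2∣⇒2∤suc 2∣Q ∘ proj₂ , P+2≤U , Q+3≤U , P+[1+Q]+3≤V)
          by-size (no Q+3≰U) = decomposition b12 (inj₂ (odd+1≡2*suc P)) (inj₁ (*-suc 2 Q))
            (2∣⇒2∤suc 2∣P ∘ proj₁ , P+3≤U , Q+2≤U , P+Q+4≤V)
            where
            P+Q+4≤V : suc P + Q + 3 ≤ V
            P+Q+4≤V = begin
              1 + P + Q + 3    ≡⟨ solve (P ∷ Q ∷ []) ⟩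
              P + (1 + Q) + 3  ≤⟨ P+[1+Q]+3≤V ⟩
              V                ∎
            P+3≤U : suc P + 2 ≤ U
            P+3≤U = squeeze (≤-pred (≰⇒> Q+3≰U)) (begin
              1 + P + 2 + (Q + 2)  ≡⟨ solve (P ∷ Q ∷ []) ⟩
              P + (1 + Q) + 2 + 2  ≤⟨ +-monoˡ-≤ 2 P+[1+Q]+2≤V ⟩
              V + 2                ∎)

    decompose-odd-even : ∀ P Q → P + 2 ≤ U → Q + 1 ≤ U → P + Q + 2 ≤ V →
                         Decomposition (1 + 2 * P) (2 * Q)
    decompose-odd-even P zero    P+2≤U _ = decompose-odd-zero P P+2≤U
    decompose-odd-even P (suc Q) = decompose-odd-positive P Q

    primitive-decomposition : ∀ {a b} → Primitive (2 * U) (2 * V) a b → Decomposition a b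
    primitive-decomposition {a} {b} (¬both , a+2≤2U , b+2≤2U , a+b+3≤2V) with evenOdd a | evenOdd b
    ... | odd P  | odd Q  =
      decompose-odd-odd P Q (halve-odd a+2≤2U) (halve-odd b+2≤2U) (halve-odd+odd {P} {Q} a+b+3≤2V)
    ... | odd P  | even Q =
      decompose-odd-even P Q (halve-odd a+2≤2U) (halve-even b+2≤2U) (halve-odd+even {P} {Q} a+b+3≤2V)
    ... | even P | odd Q  = Decomposition-swap
      (decompose-odd-even Q P (halve-odd b+2≤2U) (halve-even a+2≤2U)
        (halve-odd+even {Q} {P} (subst (λ s → s + 3 ≤ 2 * V) (+-comm (2 * P) (1 + 2 * Q)) a+b+3≤2V)))
    ... | even P | even Q = ⊥-elim (¬both (2∣2* P , 2∣2* Q))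

  -- Shell n ∣ x ∣ ∣ y ∣ is the right-hand side of the theorem, Layer n j its set of index j.
  Layer : ℕ → ℕ → ℕ → ℕ → Set
  Layer n j a b = (2 ^ j ∣ a × 2 ^ j ∣ b) × ¬ (2 ^ suc j ∣ a × 2 ^ suc j ∣ b)
                × a + 2 ^ suc j ≤ w n × b + 2 ^ suc j ≤ w n × a + b + 3 * 2 ^ j ≤ w (suc n)

  Shell : ℕ → ℕ → ℕ → Set
  Shell n a b = ∃ λ j → j ≤ n / 2 × Layer n j a b

  private
    2*-distrib-≤ : ∀ m k {n} → m + k ≤ n → 2 * m + 2 * k ≤ 2 * n
    2*-distrib-≤ m k {n} h = subst (_≤ 2 * n) (*-distribˡ-+ 2 m k) (*-monoʳ-≤ 2 h)

    2*-cancel-≤ : ∀ m k {n} → 2 * m + 2 * k ≤ 2 * n → m + k ≤ n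
    2*-cancel-≤ m k {n} h = halve-≤ (subst (_≤ 2 * n) (sym (*-distribˡ-+ 2 m k)) h)

    sum-double : ∀ a b X → 2 * a + 2 * b + 3 * (2 * X) ≡ 2 * (a + b) + 2 * (3 * X)
    sum-double a b X = solve (a ∷ b ∷ X ∷ [])

  Layer-double : ∀ {n j a b} → Layer n j a b → Layer (2 + n) (suc j) (2 * a) (2 * b)
  Layer-double {n} {j} {a} {b} ((2^j∣a , 2^j∣b) , ¬both , ba , bb , bs) =
    (*-monoʳ-∣ 2 2^j∣a , *-monoʳ-∣ 2 2^j∣b) ,
    (λ (da , db) → ¬both (*-cancelˡ-∣ 2 da , *-cancelˡ-∣ 2 db)) ,
    subst (_ ≤_) (sym (w-double n)) (2*-distrib-≤ a (2 ^ suc j) ba) ,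
    subst (_ ≤_) (sym (w-double n)) (2*-distrib-≤ b (2 ^ suc j) bb) ,
    subst₂ _≤_ (sym (sum-double a b (2 ^ j))) (sym (w-double (suc n))) (2*-distrib-≤ (a + b) (3 * 2 ^ j) bs)

  Layer-halve : ∀ {n j a b} → Layer (2 + n) (suc j) (2 * a) (2 * b) → Layer n j a b
  Layer-halve {n} {j} {a} {b} ((2^j+1∣2a , 2^j+1∣2b) , ¬both , ba , bb , bs) =
    (*-cancelˡ-∣ 2 2^j+1∣2a , *-cancelˡ-∣ 2 2^j+1∣2b) ,
    (λ (da , db) → ¬both (*-monoʳ-∣ 2 da , *-monoʳ-∣ 2 db)) ,
    2*-cancel-≤ a (2 ^ suc j) (subst (_ ≤_) (w-double n) ba) ,
    2*-cancel-≤ b (2 ^ suc j) (subst (_ ≤_) (w-double n) bb) ,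
    2*-cancel-≤ (a + b) (3 * 2 ^ j) (subst₂ _≤_ (sum-double a b (2 ^ j)) (w-double (suc n)) bs)

  Shell-double : ∀ {n a b} → Shell n a b → Shell (2 + n) (2 * a) (2 * b)
  Shell-double {n} (j , j≤n/2 , layer) =
    suc j , subst (suc j ≤_) (sym ([2+n]/2≡1+n/2 n)) (s≤s j≤n/2) , Layer-double {n} {j} layer

  Shell-primitive : ∀ {n a b} → Primitive (w n) (w (suc n)) a b → Shell n a b
  Shell-primitive {a = a} {b} prim = 0 , z≤n , (1∣ a , 1∣ b) , prim

  Shell-2+-primitive : ∀ {n a b} → Primitive (2 * w n) (2 * w (suc n)) a b → Shell (2 + n) a b
  Shell-2+-primitive {n} {a} {b} prim =
    Shell-primitive {2 + n} (subst₂ (λ U V → Primitive U V a b) (sym (w-double n)) (sym (w-double (suc n))) prim)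

  Bounded-0-0 : ∀ n → Bounded (w n) (w (suc n)) 0 0
  Bounded-0-0 n = ≤-trans (n≤1+n 2) (3≤w n) , ≤-trans (n≤1+n 2) (3≤w n) , 3≤w (suc n)

  Shell-split : ∀ {n a b} → Shell (2 + n) a b →
    Primitive (2 * w n) (2 * w (suc n)) a b ⊎
    ∃ λ a′ → ∃ λ b′ → a ≡ 2 * a′ × b ≡ 2 * b′ × Shell n a′ b′
  Shell-split {n} {a} {b} (zero , _ , _ , prim) =
    inj₁ (subst₂ (λ U V → Primitive U V a b) (w-double n) (w-double (suc n)) prim)
  Shell-split {n} {a} {b} (suc j , j+1≤ , layer@((2^j+1∣a , 2^j+1∣b) , _)) =
    inj₂ (quotient 2∣a , quotient 2∣b , a≡2a′ , b≡2b′ , j , j≤n/2 , Layer-halve {n} {j} (subst₂ (Layer (2 + n) (suc j)) a≡2a′ b≡2b′ layer))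
    where
    2∣a : 2 ∣ a
    2∣a = ∣-trans (m∣m*n {2} (2 ^ j)) 2^j+1∣a
    2∣b : 2 ∣ b
    2∣b = ∣-trans (m∣m*n {2} (2 ^ j)) 2^j+1∣b
    a≡2a′ : a ≡ 2 * quotient 2∣a
    a≡2a′ = m∣n⇒n≡m*quotient 2∣a
    b≡2b′ : b ≡ 2 * quotient 2∣b
    b≡2b′ = m∣n⇒n≡m*quotient 2∣b
    j≤n/2 : j ≤ n / 2
    j≤n/2 = s≤s⁻¹ (subst (suc j ≤_) ([2+n]/2≡1+n/2 n) j+1≤)

  Shell⇒Bounded : ∀ {n a b} → Shell n a b → Bounded (w n) (w (suc n)) a b
  Shell⇒Bounded {a = a} {b} (j , _ , _ , _ , ba , bb , bs) =
    ≤-trans (+-monoʳ-≤ a 2≤2^j+1) ba , ≤-trans (+-monoʳ-≤ b 2≤2^j+1) bb , ≤-trans (+-monoʳ-≤ (a + b) 3≤3*2^j) bs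
    where
    2≤2^j+1 : 2 ≤ 2 ^ suc j
    2≤2^j+1 = *-monoʳ-≤ 2 (m^n>0 2 j)
    3≤3*2^j : 3 ≤ 3 * 2 ^ j
    3≤3*2^j = *-monoʳ-≤ 3 (m^n>0 2 j)

  ¬Shell-0-0 : ∀ {n} → ¬ Shell n 0 0
  ¬Shell-0-0 (j , _ , _ , ¬both , _) = ¬both (_ ∣0 , _ ∣0)

  primitive? : ∀ U V a b → Dec (Primitive U V a b)
  primitive? U V a b =
    ¬? ((2 ∣? a) ×-dec (2 ∣? b)) ×-dec (a + 2 ≤? U) ×-dec (b + 2 ≤? U) ×-dec (a + b + 3 ≤? V)

  private
    Bounded⇒≤∸ : ∀ {U V a b} → Bounded U V a b → a ≤ U ∸ 2 × b ≤ U ∸ 2 × a + b ≤ V ∸ 3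
    Bounded⇒≤∸ {a = a} {b} (ba , bb , bs) =
      m+n≤o⇒m≤o∸n a ba , m+n≤o⇒m≤o∸n b bb , m+n≤o⇒m≤o∸n (a + b) bs

  Shell-level0 : ∀ {a b} → Shell 0 a b → (a ≡ 1 × b ≡ 0) ⊎ (a ≡ 0 × b ≡ 1)
  Shell-level0 {a} {b} (zero , _ , _ , ¬both , bounds) = classify a b ¬both (Bounded⇒≤∸ bounds)
    where
    classify : ∀ a b → ¬ (2 ∣ a × 2 ∣ b) → a ≤ 1 × b ≤ 1 × a + b ≤ 1 → (a ≡ 1 × b ≡ 0) ⊎ (a ≡ 0 × b ≡ 1)
    classify 0 0 ¬both _ = ⊥-elim (¬both (2 ∣0 , 2 ∣0))
    classify 0 1 _ _ = inj₂ (refl , refl)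
    classify 1 0 _ _ = inj₁ (refl , refl)
    classify 1 1 _ (_ , _ , s≤s ())
    classify 0 (suc (suc _)) _ (_ , s≤s () , _)
    classify 1 (suc (suc _)) _ (_ , s≤s () , _)
    classify (suc (suc _)) _ _ (s≤s () , _)

  Shell-level0-1-0 : Shell 0 1 0
  Shell-level0-1-0 = Shell-primitive {0} (from-yes (primitive? (w 0) (w 1) 1 0))

  Shell-level0-0-1 : Shell 0 0 1
  Shell-level0-0-1 = Shell-primitive {0} (from-yes (primitive? (w 0) (w 1) 0 1))

  Shell-level1⇒AbsB₁ : ∀ {a b} → Shell 1 a b → AbsB₁ a b
  Shell-level1⇒AbsB₁ {a} {b} (zero , _ , _ , ¬both , bounds) = classify a b ¬both (Bounded⇒≤∸ bounds)
    where
    classify : ∀ a b → ¬ (2 ∣ a × 2 ∣ b) → a ≤ 2 × b ≤ 2 × a + b ≤ 3 → AbsB₁ a b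
    classify 0 0 ¬both _ = ⊥-elim (¬both (2 ∣0 , 2 ∣0))
    classify 0 1 _ _ = b01
    classify 0 2 ¬both _ = ⊥-elim (¬both (2 ∣0 , ∣-refl))
    classify 1 0 _ _ = b10
    classify 1 1 _ _ = b11
    classify 1 2 _ _ = b12
    classify 2 0 ¬both _ = ⊥-elim (¬both (∣-refl , 2 ∣0))
    classify 2 1 _ _ = b21
    classify 2 2 _ (_ , _ , s≤s (s≤s (s≤s ())))
    classify _ (suc (suc (suc _))) _ (_ , s≤s (s≤s ()) , _)
    classify (suc (suc (suc _))) _ _ (s≤s (s≤s ()) , _)

  AbsB₁⇒Shell-level1 : ∀ {a b} → AbsB₁ a b → (a ≡ 0 × b ≡ 0) ⊎ Shell 1 a b
  AbsB₁⇒Shell-level1 b00 = inj₁ (refl , refl)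
  AbsB₁⇒Shell-level1 b10 = inj₂ (Shell-primitive {1} (from-yes (primitive? (w 1) (w 2) 1 0)))
  AbsB₁⇒Shell-level1 b01 = inj₂ (Shell-primitive {1} (from-yes (primitive? (w 1) (w 2) 0 1)))
  AbsB₁⇒Shell-level1 b11 = inj₂ (Shell-primitive {1} (from-yes (primitive? (w 1) (w 2) 1 1)))
  AbsB₁⇒Shell-level1 b12 = inj₂ (Shell-primitive {1} (from-yes (primitive? (w 1) (w 2) 1 2)))
  AbsB₁⇒Shell-level1 b21 = inj₂ (Shell-primitive {1} (from-yes (primitive? (w 1) (w 2) 2 1)))

module OnGaussianIntegers where

  open import Data.Nat using (ℕ; zero; suc)
  open import Data.Integer using (ℤ; +_; -[1+_]; -_; _+_; _-_; _*_; 0ℤ; 1ℤ; ∣_∣)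
  import Data.Nat as ℕ
  import Data.Nat.Divisibility as ℕ
  import Data.Nat.Properties as ℕ
  open import Data.Integer.Properties
    using (+-assoc; +-identityˡ; +-identityʳ; ∣-i∣≡∣i∣; ∣i+j∣≤∣i∣+∣j∣; abs-*; ∣i∣≡0⇒i≡0; pos-*)
  open import Data.Integer.Divisibility.Signed using (∣ᵤ⇒∣; ∣⇒∣ᵤ; ∣m+n∣n⇒∣m; ∣m⇒∣m*n; ∣-refl)
  open import Data.Sum using (_⊎_; inj₁; inj₂)
  open import Relation.Nullary using (¬_)
  open import Data.Empty using (⊥-elim)
  open import Function.Bundles using (_⇔_; mk⇔; Equivalence)
  open OnAbsoluteValues
  open import Data.Integer.Tactic.RingSolver using (solve)
  open import Data.Fin using (Fin; zero; suc; toℕ)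
  import Data.Vec.Functional as Vector
  open import Data.List using (_∷_; [])
  open import Data.Product using (_×_; _,_; ∃)
  open import Relation.Binary.PropositionalEquality
    using (_≡_; refl; sym; trans; cong; cong₂; subst; subst₂; module ≡-Reasoning)
  open import Function using (_∘_; _∋_)

  iᵍ : ℤ[i]
  iᵍ = (0ℤ , 1ℤ)

  double : ℤ[i] → ℤ[i]
  double (x , y) = (+ 2 * x , + 2 * y)

  *ᵍ-zeroʳ : ∀ c → c *ᵍ 0ᵍ ≡ 0ᵍ
  *ᵍ-zeroʳ (a , b) = cong₂ _,_ (solve (a ∷ b ∷ [])) (solve (a ∷ b ∷ []))

  *ᵍ-identityʳ : ∀ c → c *ᵍ 1ᵍ ≡ c
  *ᵍ-identityʳ (a , b) = cong₂ _,_ (solve (a ∷ b ∷ [])) (solve (a ∷ b ∷ []))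

  *ᵍ-distribˡ-+ᵍ : ∀ c z z′ → c *ᵍ (z +ᵍ z′) ≡ (c *ᵍ z) +ᵍ (c *ᵍ z′)
  *ᵍ-distribˡ-+ᵍ (a , b) (x , y) (x′ , y′) = cong₂ _,_
    (a * (x + x′) - b * (y + y′) ≡ (a * x - b * y) + (a * x′ - b * y′) ∋ solve (a ∷ b ∷ x ∷ y ∷ x′ ∷ y′ ∷ []))
    (a * (y + y′) + b * (x + x′) ≡ (a * y + b * x) + (a * y′ + b * x′) ∋ solve (a ∷ b ∷ x ∷ y ∷ x′ ∷ y′ ∷ []))

  *ᵍ-assoc : ∀ c c′ z → (c *ᵍ c′) *ᵍ z ≡ c *ᵍ (c′ *ᵍ z)
  *ᵍ-assoc (a , b) (a′ , b′) (x , y) = cong₂ _,_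
    ((a * a′ - b * b′) * x - (a * b′ + b * a′) * y ≡ a * (a′ * x - b′ * y) - b * (a′ * y + b′ * x)
      ∋ solve (a ∷ b ∷ a′ ∷ b′ ∷ x ∷ y ∷ []))
    ((a * a′ - b * b′) * y + (a * b′ + b * a′) * x ≡ a * (a′ * y + b′ * x) + b * (a′ * x - b′ * y)
      ∋ solve (a ∷ b ∷ a′ ∷ b′ ∷ x ∷ y ∷ []))

  *ᵍ-lcomm : ∀ c c′ z → c *ᵍ (c′ *ᵍ z) ≡ c′ *ᵍ (c *ᵍ z)
  *ᵍ-lcomm (a , b) (a′ , b′) (x , y) = cong₂ _,_
    (a * (a′ * x - b′ * y) - b * (a′ * y + b′ * x) ≡ a′ * (a * x - b * y) - b′ * (a * y + b * x)
      ∋ solve (a ∷ b ∷ a′ ∷ b′ ∷ x ∷ y ∷ []))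
    (a * (a′ * y + b′ * x) + b * (a′ * x - b′ * y) ≡ a′ * (a * y + b * x) + b′ * (a * x - b * y)
      ∋ solve (a ∷ b ∷ a′ ∷ b′ ∷ x ∷ y ∷ []))

  *ᵍ-identityˡ : ∀ z → 1ᵍ *ᵍ z ≡ z
  *ᵍ-identityˡ (x , y) = cong₂ _,_ (solve (x ∷ y ∷ [])) (solve (x ∷ y ∷ []))

  iᵍ⁴ : ∀ z → iᵍ *ᵍ (iᵍ *ᵍ (iᵍ *ᵍ (iᵍ *ᵍ z))) ≡ z
  iᵍ⁴ z = begin
    iᵍ *ᵍ (iᵍ *ᵍ (iᵍ *ᵍ (iᵍ *ᵍ z)))  ≡⟨ cong (λ t → iᵍ *ᵍ (iᵍ *ᵍ t)) (*ᵍ-assoc iᵍ iᵍ z) ⟨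
    iᵍ *ᵍ (iᵍ *ᵍ ((iᵍ *ᵍ iᵍ) *ᵍ z))  ≡⟨ cong (iᵍ *ᵍ_) (*ᵍ-assoc iᵍ (iᵍ *ᵍ iᵍ) z) ⟨
    iᵍ *ᵍ ((iᵍ *ᵍ (iᵍ *ᵍ iᵍ)) *ᵍ z)  ≡⟨ *ᵍ-assoc iᵍ (iᵍ *ᵍ (iᵍ *ᵍ iᵍ)) z ⟨
    1ᵍ *ᵍ z                          ≡⟨ *ᵍ-identityˡ z ⟩
    z                                ∎
    where open ≡-Reasoning

  +ᵍ-assoc : ∀ z z′ z″ → (z +ᵍ z′) +ᵍ z″ ≡ z +ᵍ (z′ +ᵍ z″)
  +ᵍ-assoc (x , y) (x′ , y′) (x″ , y″) = cong₂ _,_ (+-assoc x x′ x″) (+-assoc y y′ y″)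

  [1+i]²≡2i : ∀ u → 1+i *ᵍ (1+i *ᵍ u) ≡ double (iᵍ *ᵍ u)
  [1+i]²≡2i (x , y) = cong₂ _,_
    (1ℤ * (1ℤ * x - 1ℤ * y) - 1ℤ * (1ℤ * y + 1ℤ * x) ≡ + 2 * (0ℤ * x - 1ℤ * y) ∋ solve (x ∷ y ∷ []))
    (1ℤ * (1ℤ * y + 1ℤ * x) + 1ℤ * (1ℤ * x - 1ℤ * y) ≡ + 2 * (0ℤ * y + 1ℤ * x) ∋ solve (x ∷ y ∷ []))

  two-digit-step : ∀ d e u → d +ᵍ (1+i *ᵍ (e +ᵍ (1+i *ᵍ u))) ≡ (d +ᵍ (1+i *ᵍ e)) +ᵍ double (iᵍ *ᵍ u)
  two-digit-step d e u = begin
    d +ᵍ (1+i *ᵍ (e +ᵍ (1+i *ᵍ u)))            ≡⟨ cong (d +ᵍ_) (*ᵍ-distribˡ-+ᵍ 1+i e (1+i *ᵍ u)) ⟩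
    d +ᵍ ((1+i *ᵍ e) +ᵍ (1+i *ᵍ (1+i *ᵍ u)))   ≡⟨ +ᵍ-assoc d (1+i *ᵍ e) (1+i *ᵍ (1+i *ᵍ u)) ⟨
    (d +ᵍ (1+i *ᵍ e)) +ᵍ (1+i *ᵍ (1+i *ᵍ u))   ≡⟨ cong ((d +ᵍ (1+i *ᵍ e)) +ᵍ_) ([1+i]²≡2i u) ⟩
    (d +ᵍ (1+i *ᵍ e)) +ᵍ double (iᵍ *ᵍ u)      ∎
    where open ≡-Reasoning

  Σᵍ-cong : ∀ {m} {F G : Fin m → ℤ[i]} → (∀ k → F k ≡ G k) → Σᵍ F ≡ Σᵍ G
  Σᵍ-cong {zero}  _   = refl
  Σᵍ-cong {suc m} F≗G = cong₂ _+ᵍ_ (F≗G zero) (Σᵍ-cong (F≗G ∘ suc))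

  Σᵍ-*ᵍ : ∀ {m} c (G : Fin m → ℤ[i]) → Σᵍ (λ k → c *ᵍ G k) ≡ c *ᵍ Σᵍ G
  Σᵍ-*ᵍ {zero}  c G = sym (*ᵍ-zeroʳ c)
  Σᵍ-*ᵍ {suc m} c G = trans (cong ((c *ᵍ G zero) +ᵍ_) (Σᵍ-*ᵍ c (G ∘ suc)))
                            (sym (*ᵍ-distribˡ-+ᵍ c (G zero) (Σᵍ (G ∘ suc))))

  expansion : ∀ {m} → (Fin m → Digit) → ℤ[i]
  expansion v = Σᵍ (λ j → digitVal (v j) *ᵍ (1+i ^ᵍ toℕ j))

  expansion-suc : ∀ {m} (v : Fin (suc m) → Digit) →
                  expansion v ≡ digitVal (Vector.head v) +ᵍ (1+i *ᵍ expansion (Vector.tail v))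
  expansion-suc v = cong₂ _+ᵍ_ (*ᵍ-identityʳ (digitVal (v zero)))
    (trans (Σᵍ-cong (λ j → *ᵍ-lcomm (digitVal (v (suc j))) 1+i (1+i ^ᵍ toℕ j)))
           (Σᵍ-*ᵍ 1+i (λ j → digitVal (v (suc j)) *ᵍ (1+i ^ᵍ toℕ j))))

  rotate : Digit → Digit
  rotate d0  = d0
  rotate d1  = di
  rotate di  = d-1
  rotate d-1 = d-i
  rotate d-i = d1

  digitVal-rotate : ∀ d → digitVal (rotate d) ≡ iᵍ *ᵍ digitVal d
  digitVal-rotate d0  = refl
  digitVal-rotate d1  = refl
  digitVal-rotate di  = refl
  digitVal-rotate d-1 = refl
  digitVal-rotate d-i = refl

  expansion-rotate : ∀ {m} (v : Fin m → Digit) → expansion (rotate ∘ v) ≡ iᵍ *ᵍ expansion v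
  expansion-rotate v = trans
    (Σᵍ-cong (λ j → trans (cong (_*ᵍ (1+i ^ᵍ toℕ j)) (digitVal-rotate (v j)))
                          (*ᵍ-assoc iᵍ (digitVal (v j)) (1+i ^ᵍ toℕ j))))
    (Σᵍ-*ᵍ iᵍ (λ j → digitVal (v j) *ᵍ (1+i ^ᵍ toℕ j)))

  InB-*i : ∀ {n z} → InB n z → InB n (iᵍ *ᵍ z)
  InB-*i (v , refl) = rotate ∘ v , expansion-rotate v

  InB-*i³ : ∀ {n z} → InB n z → InB n (iᵍ *ᵍ (iᵍ *ᵍ (iᵍ *ᵍ z)))
  InB-*i³ = InB-*i ∘ InB-*i ∘ InB-*i

  InB-cons : ∀ {n u} d → InB n u → InB (suc n) (digitVal d +ᵍ (1+i *ᵍ u))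
  InB-cons d (v , refl) = d Vector.∷ v , expansion-suc (d Vector.∷ v)

  InB-uncons : ∀ {n z} → InB (suc n) z → ∃ λ d → ∃ λ u → InB n u × z ≡ digitVal d +ᵍ (1+i *ᵍ u)
  InB-uncons (v , refl) = Vector.head v , _ , (Vector.tail v , refl) , expansion-suc v

  +ᵍ-identityʳ : ∀ z → z +ᵍ 0ᵍ ≡ z
  +ᵍ-identityʳ (x , y) = cong₂ _,_ (+-identityʳ x) (+-identityʳ y)

  expansion-single : ∀ d → expansion {1} (λ _ → d) ≡ digitVal d
  expansion-single d = trans (+ᵍ-identityʳ _) (*ᵍ-identityʳ (digitVal d))

  InB-digit : ∀ d → InB 0 (digitVal d)
  InB-digit d = (λ _ → d) , expansion-single d

  InB-zero⇒digit : ∀ {z} → InB 0 z → ∃ λ d → digitVal d ≡ z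
  InB-zero⇒digit (v , refl) = v zero , sym (expansion-single (v zero))

  AbsB₁ᵍ : ℤ[i] → Set
  AbsB₁ᵍ (x , y) = AbsB₁ ∣ x ∣ ∣ y ∣

  two-digits : Digit → Digit → ℤ[i]
  two-digits d d′ = digitVal d +ᵍ (1+i *ᵍ digitVal d′)

  AbsB₁ᵍ-two-digits : ∀ d d′ → AbsB₁ᵍ (two-digits d d′)
  AbsB₁ᵍ-two-digits d0  d0  = b00
  AbsB₁ᵍ-two-digits d0  d1  = b11
  AbsB₁ᵍ-two-digits d0  d-1 = b11
  AbsB₁ᵍ-two-digits d0  di  = b11
  AbsB₁ᵍ-two-digits d0  d-i = b11
  AbsB₁ᵍ-two-digits d1  d0  = b10
  AbsB₁ᵍ-two-digits d1  d1  = b21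
  AbsB₁ᵍ-two-digits d1  d-1 = b01
  AbsB₁ᵍ-two-digits d1  di  = b01
  AbsB₁ᵍ-two-digits d1  d-i = b21
  AbsB₁ᵍ-two-digits d-1 d0  = b10
  AbsB₁ᵍ-two-digits d-1 d1  = b01
  AbsB₁ᵍ-two-digits d-1 d-1 = b21
  AbsB₁ᵍ-two-digits d-1 di  = b21
  AbsB₁ᵍ-two-digits d-1 d-i = b01
  AbsB₁ᵍ-two-digits di  d0  = b01
  AbsB₁ᵍ-two-digits di  d1  = b12
  AbsB₁ᵍ-two-digits di  d-1 = b10
  AbsB₁ᵍ-two-digits di  di  = b12
  AbsB₁ᵍ-two-digits di  d-i = b10
  AbsB₁ᵍ-two-digits d-i d0  = b01
  AbsB₁ᵍ-two-digits d-i d1  = b10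
  AbsB₁ᵍ-two-digits d-i d-1 = b12
  AbsB₁ᵍ-two-digits d-i di  = b10
  AbsB₁ᵍ-two-digits d-i d-i = b12

  data Signed : ℤ → ℕ → Set where
    plus  : ∀ n → Signed (+ n) n
    minus : ∀ n → Signed (- (+ n)) n

  signed : ∀ x → Signed x ∣ x ∣
  signed (+ n)    = plus n
  signed -[1+ n ] = minus (suc n)

  AbsB₁ᵍ⇒two-digits : ∀ {z} → AbsB₁ᵍ z → ∃ λ d → ∃ λ d′ → two-digits d d′ ≡ z
  AbsB₁ᵍ⇒two-digits {x , y} = by-signs (signed x) (signed y)
    where
    by-signs : ∀ {x y a b} → Signed x a → Signed y b → AbsB₁ a b → ∃ λ d → ∃ λ d′ → two-digits d d′ ≡ (x , y)
    by-signs (plus _)  (plus _)  b00 = d0  , d0  , refl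
    by-signs (plus _)  (minus _) b00 = d0  , d0  , refl
    by-signs (minus _) (plus _)  b00 = d0  , d0  , refl
    by-signs (minus _) (minus _) b00 = d0  , d0  , refl
    by-signs (plus _)  (plus _)  b10 = d1  , d0  , refl
    by-signs (plus _)  (minus _) b10 = d1  , d0  , refl
    by-signs (minus _) (plus _)  b10 = d-1 , d0  , refl
    by-signs (minus _) (minus _) b10 = d-1 , d0  , refl
    by-signs (plus _)  (plus _)  b01 = d1  , di  , refl
    by-signs (plus _)  (minus _) b01 = d1  , d-1 , refl
    by-signs (minus _) (plus _)  b01 = d1  , di  , refl
    by-signs (minus _) (minus _) b01 = d1  , d-1 , refl
    by-signs (plus _)  (plus _)  b11 = d0  , d1  , refl
    by-signs (plus _)  (minus _) b11 = d0  , d-i , refl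
    by-signs (minus _) (plus _)  b11 = d0  , di  , refl
    by-signs (minus _) (minus _) b11 = d0  , d-1 , refl
    by-signs (plus _)  (plus _)  b12 = di  , d1  , refl
    by-signs (plus _)  (minus _) b12 = d-i , d-i , refl
    by-signs (minus _) (plus _)  b12 = di  , di  , refl
    by-signs (minus _) (minus _) b12 = d-i , d-1 , refl
    by-signs (plus _)  (plus _)  b21 = d1  , d1  , refl
    by-signs (plus _)  (minus _) b21 = d1  , d-i , refl
    by-signs (minus _) (plus _)  b21 = d-1 , di  , refl
    by-signs (minus _) (minus _) b21 = d-1 , d-1 , refl

  B₁+2·_ : (ℤ[i] → Set) → ℤ[i] → Set
  (B₁+2· X) z = ∃ λ e → ∃ λ u → AbsB₁ᵍ e × X u × z ≡ e +ᵍ double u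

  InB-2+⇒ : ∀ {n z} → InB (suc (suc n)) z → (B₁+2· InB n) z
  InB-2+⇒ h with InB-uncons h
  ... | d , u′ , h′ , z≡ with InB-uncons h′
  ...   | d′ , u , hu , u′≡ =
    two-digits d d′ , iᵍ *ᵍ u , AbsB₁ᵍ-two-digits d d′ , InB-*i hu ,
    trans z≡ (trans (cong (λ t → digitVal d +ᵍ (1+i *ᵍ t)) u′≡) (two-digit-step (digitVal d) (digitVal d′) u))

  InB-2+⇐ : ∀ {n z} → (B₁+2· InB n) z → InB (suc (suc n)) z
  InB-2+⇐ {n} {z} (e , u , he , hu , z≡) with AbsB₁ᵍ⇒two-digits {e} he
  ... | d , d′ , digits≡e = subst (InB (suc (suc n))) (sym z≡′) (InB-cons d (InB-cons d′ (InB-*i³ hu)))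
    where
    open ≡-Reasoning
    z≡′ : z ≡ digitVal d +ᵍ (1+i *ᵍ (digitVal d′ +ᵍ (1+i *ᵍ (iᵍ *ᵍ (iᵍ *ᵍ (iᵍ *ᵍ u))))))
    z≡′ = begin
      z                                                                   ≡⟨ z≡ ⟩
      e +ᵍ double u                                                       ≡⟨ cong (_+ᵍ double u) digits≡e ⟨
      two-digits d d′ +ᵍ double u                                         ≡⟨ cong (λ t → two-digits d d′ +ᵍ double t) (iᵍ⁴ u) ⟨
      two-digits d d′ +ᵍ double (iᵍ *ᵍ (iᵍ *ᵍ (iᵍ *ᵍ (iᵍ *ᵍ u))))         ≡⟨ two-digit-step (digitVal d) (digitVal d′) (iᵍ *ᵍ (iᵍ *ᵍ (iᵍ *ᵍ u))) ⟨
      digitVal d +ᵍ (1+i *ᵍ (digitVal d′ +ᵍ (1+i *ᵍ (iᵍ *ᵍ (iᵍ *ᵍ (iᵍ *ᵍ u)))))) ∎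

  InB-one⇒AbsB₁ᵍ : ∀ {z} → InB 1 z → AbsB₁ᵍ z
  InB-one⇒AbsB₁ᵍ h with InB-uncons h
  ... | d , _ , h₀ , z≡ with InB-zero⇒digit h₀
  ...   | d′ , refl = subst AbsB₁ᵍ (sym z≡) (AbsB₁ᵍ-two-digits d d′)

  AbsB₁ᵍ⇒InB-one : ∀ {z} → AbsB₁ᵍ z → InB 1 z
  AbsB₁ᵍ⇒InB-one {z} h with AbsB₁ᵍ⇒two-digits {z} h
  ... | d , d′ , digits≡z = subst (InB 1) digits≡z (InB-cons d (InB-digit d′))

  private
    cancel-+ : ∀ i j → i ≡ - j + (i + j)
    cancel-+ i j = solve (i ∷ j ∷ [])

    neg-digit+2* : ∀ e u → - (e + + 2 * u) ≡ - e + + 2 * (- u)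
    neg-digit+2* e u = solve (e ∷ u ∷ [])

    lift-nonneg : ∀ {a α p} → a ≡± α +2* p →
                  ∃ λ e → ∃ λ u → ∣ e ∣ ≡ α × ∣ u ∣ ≡ p × + a ≡ e + + 2 * u
    lift-nonneg {α = α} {p} (inj₁ refl) = + α , + p , refl , refl , cong (_+_ (+ α)) (pos-* 2 p)
    lift-nonneg {a} {α} {p} (inj₂ a+α≡2p) =
      - + α , + p , ∣-i∣≡∣i∣ (+ α) , refl , trans (cancel-+ (+ a) (+ α)) (cong (_+_ (- + α)) (trans (cong +_ a+α≡2p) (pos-* 2 p)))

  lift-split : ∀ {α p} x → ∣ x ∣ ≡± α +2* p → ∃ λ e → ∃ λ u → ∣ e ∣ ≡ α × ∣ u ∣ ≡ p × x ≡ e + + 2 * u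
  lift-split x = by-sign (signed x)
    where
    by-sign : ∀ {x a α p} → Signed x a → a ≡± α +2* p →
              ∃ λ e → ∃ λ u → ∣ e ∣ ≡ α × ∣ u ∣ ≡ p × x ≡ e + + 2 * u
    by-sign (plus _)  split = lift-nonneg split
    by-sign (minus _) split with lift-nonneg split
    ... | e , u , ∣e∣≡α , ∣u∣≡p , a≡ =
      - e , - u , trans (∣-i∣≡∣i∣ e) ∣e∣≡α , trans (∣-i∣≡∣i∣ u) ∣u∣≡p , trans (cong -_ a≡) (neg-digit+2* e u)

  ∣e+2u∣≤∣e∣+2∣u∣ : ∀ e u → ∣ e + + 2 * u ∣ ℕ.≤ ∣ e ∣ ℕ.+ 2 ℕ.* ∣ u ∣
  ∣e+2u∣≤∣e∣+2∣u∣ e u = ℕ.≤-trans (∣i+j∣≤∣i∣+∣j∣ e (+ 2 * u)) (ℕ.≤-reflexive (cong (∣ e ∣ ℕ.+_) (abs-* (+ 2) u)))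

  2∣∣e+2u∣⇒2∣∣e∣ : ∀ e u → 2 ℕ.∣ ∣ e + + 2 * u ∣ → 2 ℕ.∣ ∣ e ∣
  2∣∣e+2u∣⇒2∣∣e∣ e u h = ∣⇒∣ᵤ (∣m+n∣n⇒∣m {+ 2} {e} {+ 2 * u} (∣ᵤ⇒∣ {+ 2} {e + + 2 * u} h) (∣m⇒∣m*n u ∣-refl))

  ShellOrZero : ℕ → ℤ[i] → Set
  ShellOrZero n (x , y) = (x , y) ≡ 0ᵍ ⊎ Shell n ∣ x ∣ ∣ y ∣

  ShellOrZero⇒Bounded : ∀ {n x y} → ShellOrZero n (x , y) → Bounded (w n) (w (suc n)) ∣ x ∣ ∣ y ∣
  ShellOrZero⇒Bounded {n} (inj₁ refl) = Bounded-0-0 n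
  ShellOrZero⇒Bounded {n} (inj₂ shell) = Shell⇒Bounded {n} shell

  B₁+2·-map : ∀ {X Y : ℤ[i] → Set} → (∀ {u} → X u → Y u) → ∀ {z} → (B₁+2· X) z → (B₁+2· Y) z
  B₁+2·-map f (e , u , he , hu , z≡) = e , u , he , f hu , z≡

  B₁+2·-split : ∀ {n x y α β p q} → AbsB₁ α β → ∣ x ∣ ≡± α +2* p → ∣ y ∣ ≡± β +2* q → Shell n p q →
                (B₁+2· ShellOrZero n) (x , y)
  B₁+2·-split {n} {x} {y} digit split-x split-y shell with lift-split x split-x | lift-split y split-y
  ... | ex , ux , ∣ex∣ , ∣ux∣ , x≡ | ey , uy , ∣ey∣ , ∣uy∣ , y≡ =
    (ex , ey) , (ux , uy) , subst₂ AbsB₁ (sym ∣ex∣) (sym ∣ey∣) digit ,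
    inj₂ (subst₂ (Shell n) (sym ∣ux∣) (sym ∣uy∣) shell) , cong₂ _,_ x≡ y≡

  ShellOrZero-2+⇒ : ∀ {n z} → ShellOrZero (suc (suc n)) z → (B₁+2· ShellOrZero n) z
  ShellOrZero-2+⇒ {z = _ , _} (inj₁ refl) = 0ᵍ , 0ᵍ , b00 , inj₁ refl , refl
  ShellOrZero-2+⇒ {n} {_ , _} (inj₂ shell) with Shell-split {n} shell
  ... | inj₂ (_ , _ , x≡ , y≡ , halved) = B₁+2·-split {n} b00 (inj₁ x≡) (inj₁ y≡) halved
  ... | inj₁ prim with DigitChoice.primitive-decomposition (3≤w n) (w<w-suc n) (w-suc+2≤2*w n) (2∣w-suc n) prim
  ...   | DigitChoice.decomposition digit split-x split-y quotient =
    B₁+2·-split {n} digit split-x split-y (Shell-primitive {n} quotient)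

  ShellOrZero-double : ∀ {n u} → ShellOrZero n u → ShellOrZero (suc (suc n)) (double u)
  ShellOrZero-double {u = _ , _} (inj₁ refl) = inj₁ refl
  ShellOrZero-double {n} {ux , uy} (inj₂ shell) =
    inj₂ (subst₂ (Shell (suc (suc n))) (sym (abs-* (+ 2) ux)) (sym (abs-* (+ 2) uy)) (Shell-double {n} shell))

  ShellOrZero-digit+double : ∀ {n e u} → AbsB₁ᵍ e → ShellOrZero n u → ShellOrZero (suc (suc n)) (e +ᵍ double u)
  ShellOrZero-digit+double {n} {ex , ey} {ux , uy} digit su with AbsB₁-zero-or-primitive digit
  ... | inj₁ (∣ex∣≡0 , ∣ey∣≡0) = subst (ShellOrZero (suc (suc n))) (sym e+2u≡2u) (ShellOrZero-double {n} su)
    where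
    e+2u≡2u : (ex , ey) +ᵍ double (ux , uy) ≡ double (ux , uy)
    e+2u≡2u = cong₂ _,_
      (trans (cong (λ t → t + + 2 * ux) (∣i∣≡0⇒i≡0 {ex} ∣ex∣≡0)) (+-identityˡ (+ 2 * ux)))
      (trans (cong (λ t → t + + 2 * uy) (∣i∣≡0⇒i≡0 {ey} ∣ey∣≡0)) (+-identityˡ (+ 2 * uy)))
  ... | inj₂ ¬both = inj₂ (Shell-2+-primitive {n} (¬both′ , Bounded-digit+2* digit
          (∣e+2u∣≤∣e∣+2∣u∣ ex ux) (∣e+2u∣≤∣e∣+2∣u∣ ey uy) (ShellOrZero⇒Bounded {n} su)))
    where
    ¬both′ : ¬ (2 ℕ.∣ ∣ ex + + 2 * ux ∣ × 2 ℕ.∣ ∣ ey + + 2 * uy ∣)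
    ¬both′ (dx , dy) = ¬both (2∣∣e+2u∣⇒2∣∣e∣ ex ux dx , 2∣∣e+2u∣⇒2∣∣e∣ ey uy dy)

  ShellOrZero-2+⇐ : ∀ {n z} → (B₁+2· ShellOrZero n) z → ShellOrZero (suc (suc n)) z
  ShellOrZero-2+⇐ {n} (e , u , digit , su , z≡) =
    subst (ShellOrZero (suc (suc n))) (sym z≡) (ShellOrZero-digit+double {n} {e} {u} digit su)

  ShellOrZero-digit : ∀ d → ShellOrZero 0 (digitVal d)
  ShellOrZero-digit d0  = inj₁ refl
  ShellOrZero-digit d1  = inj₂ Shell-level0-1-0
  ShellOrZero-digit d-1 = inj₂ Shell-level0-1-0
  ShellOrZero-digit di  = inj₂ Shell-level0-0-1
  ShellOrZero-digit d-i = inj₂ Shell-level0-0-1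

  ShellOrZero-level0⇒digit : ∀ {z} → ShellOrZero 0 z → ∃ λ d → digitVal d ≡ z
  ShellOrZero-level0⇒digit {_ , _} (inj₁ refl)  = d0 , refl
  ShellOrZero-level0⇒digit {x , y} (inj₂ shell) = by-signs (signed x) (signed y) (Shell-level0 shell)
    where
    by-signs : ∀ {x y a b} → Signed x a → Signed y b → (a ≡ 1 × b ≡ 0) ⊎ (a ≡ 0 × b ≡ 1) →
               ∃ λ d → digitVal d ≡ (x , y)
    by-signs (plus _)  (plus _)  (inj₁ (refl , refl)) = d1  , refl
    by-signs (plus _)  (minus _) (inj₁ (refl , refl)) = d1  , refl
    by-signs (minus _) (plus _)  (inj₁ (refl , refl)) = d-1 , refl
    by-signs (minus _) (minus _) (inj₁ (refl , refl)) = d-1 , refl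
    by-signs (plus _)  (plus _)  (inj₂ (refl , refl)) = di  , refl
    by-signs (plus _)  (minus _) (inj₂ (refl , refl)) = d-i , refl
    by-signs (minus _) (plus _)  (inj₂ (refl , refl)) = di  , refl
    by-signs (minus _) (minus _) (inj₂ (refl , refl)) = d-i , refl

  AbsB₁ᵍ⇒ShellOrZero-level1 : ∀ {z} → AbsB₁ᵍ z → ShellOrZero 1 z
  AbsB₁ᵍ⇒ShellOrZero-level1 {x , y} h with AbsB₁⇒Shell-level1 h
  ... | inj₁ (∣x∣≡0 , ∣y∣≡0) = inj₁ (cong₂ _,_ (∣i∣≡0⇒i≡0 {x} ∣x∣≡0) (∣i∣≡0⇒i≡0 {y} ∣y∣≡0))
  ... | inj₂ shell           = inj₂ shell

  ShellOrZero-level1⇒AbsB₁ᵍ : ∀ {z} → ShellOrZero 1 z → AbsB₁ᵍ z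
  ShellOrZero-level1⇒AbsB₁ᵍ {_ , _} (inj₁ refl)  = b00
  ShellOrZero-level1⇒AbsB₁ᵍ {_ , _} (inj₂ shell) = Shell-level1⇒AbsB₁ shell

  InB⇔ShellOrZero : ∀ n {z} → InB n z ⇔ ShellOrZero n z
  InB⇔ShellOrZero 0 = mk⇔
    (λ h → let d , d≡z = InB-zero⇒digit h in subst (ShellOrZero 0) d≡z (ShellOrZero-digit d))
    (λ s → let d , d≡z = ShellOrZero-level0⇒digit s in subst (InB 0) d≡z (InB-digit d))
  InB⇔ShellOrZero 1 {z} = mk⇔
    (AbsB₁ᵍ⇒ShellOrZero-level1 {z} ∘ InB-one⇒AbsB₁ᵍ)
    (AbsB₁ᵍ⇒InB-one {z} ∘ ShellOrZero-level1⇒AbsB₁ᵍ {z})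
  InB⇔ShellOrZero (suc (suc n)) = mk⇔
    (ShellOrZero-2+⇐ {n} ∘ B₁+2·-map (Equivalence.to (InB⇔ShellOrZero n)) ∘ InB-2+⇒)
    (InB-2+⇐ ∘ B₁+2·-map (Equivalence.from (InB⇔ShellOrZero n)) ∘ ShellOrZero-2+⇒ {n})

  InB∖0⇔Shell : ∀ n x y → (InB n (x , y) × ¬ ((x , y) ≡ 0ᵍ)) ⇔ Shell n ∣ x ∣ ∣ y ∣
  InB∖0⇔Shell n x y = mk⇔ to from
    where
    to : InB n (x , y) × ¬ ((x , y) ≡ 0ᵍ) → Shell n ∣ x ∣ ∣ y ∣
    to (h , nonzero) with Equivalence.to (InB⇔ShellOrZero n) h
    ... | inj₁ x+iy≡0 = ⊥-elim (nonzero x+iy≡0)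
    ... | inj₂ shell  = shell
    from : Shell n ∣ x ∣ ∣ y ∣ → InB n (x , y) × ¬ ((x , y) ≡ 0ᵍ)
    from shell = Equivalence.from (InB⇔ShellOrZero n) (inj₂ shell) , λ { refl → ¬Shell-0-0 {n} shell }

open import Data.Nat as ℕ using (ℕ; suc; _/_)
open import Data.Integer as ℤ using (ℤ; +_; _-_; ∣_∣; _≤_)
open import Data.Product using (_×_; _,_; ∃)
open import Relation.Nullary using (¬_)
open import Relation.Binary.PropositionalEquality using (_≡_)
open import Function.Bundles using (_⇔_)

open import Data.Integer.Properties using (drop‿+≤+; +-monoˡ-≤)
open import Data.Integer.Tactic.RingSolver using (solve)
open import Data.List using (_∷_; [])
open import Relation.Binary.PropositionalEquality using (subst)
open import Function.Bundles using (mk⇔)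
open import Function.Properties.Equivalence using () renaming (trans to ⇔-trans)
open OnGaussianIntegers using (InB∖0⇔Shell)

private
  +≤+-+⇒+≤ : ∀ {a c d} → + a ≤ + c - + d → a ℕ.+ d ℕ.≤ c
  +≤+-+⇒+≤ {a} {c} {d} h = drop‿+≤+ (subst (+ (a ℕ.+ d) ≤_) (i-j+j≡i (+ c) (+ d)) (+-monoˡ-≤ (+ d) h))
    where
    i-j+j≡i : ∀ i j → i - j ℤ.+ j ≡ i
    i-j+j≡i i j = solve (i ∷ j ∷ [])

  +≤⇒+≤+-+ : ∀ {a c d} → a ℕ.+ d ℕ.≤ c → + a ≤ + c - + d
  +≤⇒+≤+-+ {a} {c} {d} h = subst (_≤ + c - + d) (i+j-j≡i (+ a) (+ d)) (+-monoˡ-≤ (ℤ.- + d) (ℤ.+≤+ h))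
    where
    i+j-j≡i : ∀ i j → i ℤ.+ j - j ≡ i
    i+j-j≡i i j = solve (i ∷ j ∷ [])

mainTheorem3 : (n : ℕ) (x y : ℤ) →
    (InB n (x , y) × ¬ ((x , y) ≡ 0ᵍ))
    ⇔ (∃ λ (j : ℕ) → j ℕ.≤ n / 2
         × j ∥ (x , y)
         × + ∣ x ∣ ≤ + w n - + (2 ℕ.^ suc j)
         × + ∣ y ∣ ≤ + w n - + (2 ℕ.^ suc j)
         × + (∣ x ∣ ℕ.+ ∣ y ∣) ≤ + w (suc n) - + (3 ℕ.* 2 ℕ.^ j))
mainTheorem3 n x y = ⇔-trans (InB∖0⇔Shell n x y) (mk⇔
  (λ (j , j≤n/2 , divides , ¬divides , x-bound , y-bound , sum-bound) →
     j , j≤n/2 , (divides , ¬divides) , +≤⇒+≤+-+ x-bound , +≤⇒+≤+-+ y-bound , +≤⇒+≤+-+ sum-bound)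
  (λ (j , j≤n/2 , (divides , ¬divides) , x-bound , y-bound , sum-bound) →
     j , j≤n/2 , divides , ¬divides , +≤+-+⇒+≤ x-bound , +≤+-+⇒+≤ y-bound , +≤+-+⇒+≤ sum-bound))
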